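{- Let $(\lambda,\mu)\in{\sf Kostka}_r^{\mathbb Z}$. Then $A^*(\lambda,\mu)$ is $*$-reducible if and only if $A(\lambda,\mu)$ is reducible.
   Context: ${\sf Kostka}_r^{\mathbb Z}$ is the set of pairs $(\lambda,\mu)$ of partitions with at most $r$ nonzero parts, $|\lambda|=|\mu|$, $\sum_{i\le t}\lambda_i\ge\sum_{i\le t}\mu_i$ for all $t$. $\lambda'$ is the conjugate partition. Canonical (Ryser) matrix $A(\lambda,\mu)$: let $s=\lambda_1$. Start with the $r\times s$ $\{0,1\}$-matrix whose row $i$ has $\mu_i$ ones in columns $1,\ldots,\mu_i$. For $j=s,s-1,\ldots,1$ in turn: looking only at columns $1,\ldots,j$ of the current matrix, choose $\lambda'_j$ rows, taking rows with the largest number of $1$'s in columns $1,\ldots,j$ and breaking ties by preferring rows further south; in each chosen row, move the rightmost $1$ among columns $1,\ldots,j$ to column $j$. The final matrix is $A(\lambda,\mu)$. Define $A^*(\lambda,\mu)_{i,j}=A(\lambda,\mu)_{i,j}-A(\lambda,\mu)_{i+1,j}$ (with $A(\lambda,\mu)_{r+1,j}:=0$), and $\mu^*\in\mathbb{Z}_{\ge0}^r$ by $\mu^*_i=\mu_i-\mu_{i+1}$ (with $\mu_{r+1}:=0$). $A(\lambda,\mu)$ is \emph{reducible} if there is a nontrivial subset $S$ of its columns (nonempty and not all) such that the sum of the columns in $S$ and the sum of the columns not in $S$ are both weakly decreasing nonnegative vectors (partitions with at most $r$ parts). $A^*(\lambda,\mu)$ is \emph{$*$-reducible} if there is a nontrivial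 subset $S$ of its columns whose sum $v^*$ satisfies $0\le v^*_i\le\mu^*_i$ for all $i$. -}

module Defs where

open import Data.Nat using (ℕ; zero; suc; _+_; _∸_; _≤_; _<_; _≡ᵇ_; _<ᵇ_)
open import Data.Bool using (Bool; true; false; if_then_else_; _∧_; _∨_; not)
open import Data.Fin using (Fin; toℕ) renaming (zero to fzero; suc to fsuc)
open import Data.Integer as ℤ using (ℤ; +_)
open import Data.Maybe using (Maybe; just; nothing)
open import Data.Product using (Σ; _×_; ∃; ∃-syntax; _,_)
open import Relation.Binary.PropositionalEquality using (_≡_)

-- Partitions with at most r parts are vectors  Fin r → ℕ  (row i is 0-based).
-- Rows and columns are 0-based throughout: paper's row i ↔ index i-1,
-- paper's column j ↔ index j-1.

sumFin : ∀ {n} → (Fin n → ℕ) → ℕ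
sumFin {zero}  f = 0
sumFin {suc n} f = f fzero + sumFin (λ i → f (fsuc i))

sumFinℤ : ∀ {n} → (Fin n → ℤ) → ℤ
sumFinℤ {zero}  f = + 0
sumFinℤ {suc n} f = f fzero ℤ.+ sumFinℤ (λ i → f (fsuc i))

sumTo : (ℕ → ℕ) → ℕ → ℕ
sumTo f zero    = 0
sumTo f (suc t) = sumTo f t + f t

countBelow : ℕ → (ℕ → Bool) → ℕ
countBelow zero    P = 0
countBelow (suc n) P = countBelow n P + (if P n then 1 else 0)

ext : ∀ {r} → (Fin r → ℕ) → ℕ → ℕ
ext {zero}  v i       = 0
ext {suc r} v zero    = v fzero
ext {suc r} v (suc i) = ext (λ k → v (fsuc k)) i

WeaklyDecreasing : ∀ {r} → (Fin r → ℕ) → Set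
WeaklyDecreasing {r} v = ∀ (i j : Fin r) → toℕ i ≤ toℕ j → v j ≤ v i

size : ∀ {r} → (Fin r → ℕ) → ℕ
size v = sumFin v

Kostka : (r : ℕ) → (Fin r → ℕ) → (Fin r → ℕ) → Set
Kostka r lam mu =
  WeaklyDecreasing lam × WeaklyDecreasing mu × size lam ≡ size mu ×
  (∀ t → t ≤ r → sumTo (ext mu) t ≤ sumTo (ext lam) t)

-- λ₁ (0 if r = 0)
firstPart : ∀ {r} → (Fin r → ℕ) → ℕ
firstPart v = ext v 0

conj : ∀ {r} → (Fin r → ℕ) → ℕ → ℕ
conj {r} lam j = countBelow r (λ i → j ≤ᵇ' ext lam i)
  where
  _≤ᵇ'_ : ℕ → ℕ → Bool
  a ≤ᵇ' b = a <ᵇ suc b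

Mat : Set
Mat = ℕ → ℕ → ℕ

initMat : ∀ {r} → (Fin r → ℕ) → Mat
initMat mu i c = if c <ᵇ ext mu i then 1 else 0

rowCount : Mat → ℕ → ℕ → ℕ
rowCount M k i = sumTo (M i) k

rightmostOne : Mat → ℕ → ℕ → Maybe ℕ
rightmostOne M zero    i = nothing
rightmostOne M (suc c) i = if M i c ≡ᵇ 1 then just c else rightmostOne M c i

-- row i' comes before row i in the priority order at stage k (columns
-- 0 … k-1): more ones first, ties broken in favour of the row further south
before : Mat → ℕ → ℕ → ℕ → Bool
before M k i' i =
  (rowCount M k i <ᵇ rowCount M k i') ∨
  ((rowCount M k i' ≡ᵇ rowCount M k i) ∧ (i <ᵇ i'))

-- the chosen rows at stage k are the first λ'_k rows in the priority order
chosen : ℕ → Mat → ℕ → ℕ → ℕ → Bool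
chosen r M k m i = (i <ᵇ r) ∧ (countBelow r (λ i' → before M k i' i) <ᵇ m)

-- one step for paper's column j = k (1-based), i.e. column index k-1:
-- in each chosen row move the rightmost 1 among columns 0 … k-1 to column k-1
moveRow : (ℕ → ℕ) → Maybe ℕ → ℕ → ℕ → ℕ
moveRow row nothing  k c = row c
moveRow row (just p) k c =
  if c ≡ᵇ (k ∸ 1) then 1 else (if c ≡ᵇ p then 0 else row c)

step : ∀ {r} → (Fin r → ℕ) → Mat → ℕ → Mat
step {r} lam M k i c =
  if chosen r M k (conj lam k) i
  then moveRow (M i) (rightmostOne M k i) k c
  else M i c

run : ∀ {r} → (Fin r → ℕ) → Mat → ℕ → Mat
run lam M zero    = M
run lam M (suc k) = run lam (step lam M (suc k)) k

canonical : ∀ {r} → (lam mu : Fin r → ℕ) → Fin r → Fin (firstPart lam) → ℕ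
canonical lam mu i c = run lam (initMat mu) (firstPart lam) (toℕ i) (toℕ c)

canonicalStar : ∀ {r} → (lam mu : Fin r → ℕ) → Fin r → Fin (firstPart lam) → ℤ
canonicalStar {r} lam mu i c =
  (+ A (toℕ i)) ℤ.- (+ A (suc (toℕ i)))
  where
  A : ℕ → ℕ
  A k = if k <ᵇ r then run lam (initMat mu) (firstPart lam) k (toℕ c) else 0

muStar : ∀ {r} → (Fin r → ℕ) → Fin r → ℤ
muStar mu i = (+ ext mu (toℕ i)) ℤ.- (+ ext mu (suc (toℕ i)))

Nontrivial : ∀ {s} → (Fin s → Bool) → Set
Nontrivial {s} S = (∃[ c ] S c ≡ true) × (∃[ c ] S c ≡ false)

colSum : ∀ {r s} → (Fin r → Fin s → ℕ) → (Fin s → Bool) → Fin r → ℕ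
colSum A S i = sumFin (λ c → if S c then A i c else 0)

colSumℤ : ∀ {r s} → (Fin r → Fin s → ℤ) → (Fin s → Bool) → Fin r → ℤ
colSumℤ A S i = sumFinℤ (λ c → if S c then A i c else + 0)

-- a vector in ℕ^r is a partition with at most r parts (nonnegativity is automatic)
IsPartition : ∀ {r} → (Fin r → ℕ) → Set
IsPartition v = WeaklyDecreasing v

Reducible : ∀ {r s} → (Fin r → Fin s → ℕ) → Set
Reducible {r} {s} A = Σ (Fin s → Bool) λ S →
  Nontrivial S × IsPartition (colSum A S) × IsPartition (colSum A (λ c → not (S c)))

StarReducible : ∀ {r s} → (Fin r → Fin s → ℤ) → (Fin r → ℤ) → Set
StarReducible {r} {s} Astar mustar = Σ (Fin s → Bool) λ S →
  Nontrivial S ×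
  (∀ i → (+ 0 ℤ.≤ colSumℤ Astar S i) × (colSumℤ Astar S i ℤ.≤ mustar i))

-- Each step of Ryser's algorithm moves a 1 within its row onto an empty
-- column, so every row of A(λ,μ) still sums to μᵢ (here μᵢ ≤ μ₁ ≤ λ₁ is needed,
-- so that the initial rows fit into λ₁ columns). Hence for a set S of columns
-- with column sums v and complementary column sums w we have v + w = μ, the
-- column sums of A* over S are vᵢ − vᵢ₊₁, and μ*ᵢ = (vᵢ − vᵢ₊₁) + (wᵢ − wᵢ₊₁).
-- The condition 0 ≤ vᵢ − vᵢ₊₁ ≤ μ*ᵢ thus says exactly that both v and w
-- descend at row i, so ∗-reducibility via S is reducibility via S.
module Submission where

open import Defs
open import Data.Nat using (ℕ)
open import Data.Fin using (Fin)
open import Function.Bundles using (_⇔_)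

open import Algebra.Properties.CommutativeSemigroup as CSemigroup using ()
open import Data.Bool using (Bool; true; false; if_then_else_; not; T)
open import Data.Bool.Properties using (T-≡; if-cong)
open import Data.Empty using (⊥-elim)
open import Data.Fin using (toℕ; fromℕ<) renaming (zero to fzero; suc to fsuc)
open import Data.Fin.Properties using (toℕ-fromℕ<)
open import Data.Integer as ℤ using (ℤ; +≤+; 0ℤ)
import Data.Integer.Properties as ℤ
open import Data.Integer.Tactic.RingSolver using (solve-∀)
open import Data.Maybe using (just; nothing)
open import Data.Nat using (zero; suc; _+_; _⊓_; _≤_; _<_; _≡ᵇ_; _<ᵇ_; _∸_; z≤n; s≤s; s≤s⁻¹)
open import Data.Nat.Properties
open import Data.Sum using (inj₁; inj₂)
open import Data.Product using (_×_; _,_; proj₁; proj₂; map₁)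
open import Function using (_∘_)
open import Function.Bundles using (mk⇔; Equivalence)
open import Relation.Binary using (_Preserves_⟶_)
open import Relation.Nullary using (¬_; yes; no)
open import Relation.Binary.PropositionalEquality

open CSemigroup +-commutativeSemigroup using (xy∙z≈xz∙y; x∙yz≈y∙xz)

¬T⇒≡false : ∀ {b} → ¬ T b → b ≡ false
¬T⇒≡false {true}  ¬t = ⊥-elim (¬t _)
¬T⇒≡false {false} _  = refl

≡ᵇ-refl : ∀ n → (n ≡ᵇ n) ≡ true
≡ᵇ-refl n = Equivalence.to T-≡ (≡⇒≡ᵇ n n refl)

≢⇒≡ᵇ≡false : ∀ {m n} → m ≢ n → (m ≡ᵇ n) ≡ false
≢⇒≡ᵇ≡false {m} {n} m≢n = ¬T⇒≡false (m≢n ∘ ≡ᵇ⇒≡ m n)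

<⇒<ᵇ≡true : ∀ {m n} → m < n → (m <ᵇ n) ≡ true
<⇒<ᵇ≡true = Equivalence.to T-≡ ∘ <⇒<ᵇ

≥⇒<ᵇ≡false : ∀ {m n} → n ≤ m → (m <ᵇ n) ≡ false
≥⇒<ᵇ≡false {m} {n} n≤m = ¬T⇒≡false (λ t → <⇒≱ (<ᵇ⇒< m n t) n≤m)

sumTo-cong : ∀ {f g} n → (∀ c → c < n → f c ≡ g c) → sumTo f n ≡ sumTo g n
sumTo-cong zero    f≗g = refl
sumTo-cong (suc n) f≗g =
  cong₂ _+_ (sumTo-cong n (λ c c<n → f≗g c (m<n⇒m<1+n c<n))) (f≗g n ≤-refl)

sumTo-update : ∀ {f g} n {p} → p < n → (∀ c → c ≢ p → g c ≡ f c) →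
  sumTo g n + f p ≡ sumTo f n + g p
sumTo-update {f} {g} (suc m) {p} p<1+m g≗f with m ≟ p
... | yes refl = begin
  sumTo g m + g m + f m ≡⟨ cong (λ x → x + g m + f m) (sumTo-cong m (λ c c<m → g≗f c (<⇒≢ c<m))) ⟩
  sumTo f m + g m + f m ≡⟨ xy∙z≈xz∙y (sumTo f m) (g m) (f m) ⟩
  sumTo f m + f m + g m ∎
  where open ≡-Reasoning
... | no m≢p = begin
  sumTo g m + g m + f p ≡⟨ cong (λ x → sumTo g m + x + f p) (g≗f m m≢p) ⟩
  sumTo g m + f m + f p ≡⟨ xy∙z≈xz∙y (sumTo g m) (f m) (f p) ⟩
  sumTo g m + f p + f m ≡⟨ cong (_+ f m) (sumTo-update m p<m g≗f) ⟩
  sumTo f m + g p + f m ≡⟨ xy∙z≈xz∙y (sumTo f m) (g p) (f m) ⟩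
  sumTo f m + f m + g p ∎
  where
  open ≡-Reasoning
  p<m : p < m
  p<m = ≤∧≢⇒< (s≤s⁻¹ p<1+m) (m≢p ∘ sym)

sumTo-indicator : ∀ m n → sumTo (λ c → if c <ᵇ m then 1 else 0) n ≡ m ⊓ n
sumTo-indicator m zero = sym (⊓-zeroʳ m)
sumTo-indicator m (suc n) with n <? m
... | yes n<m
  rewrite <⇒<ᵇ≡true n<m | sumTo-indicator m n
        | m≥n⇒m⊓n≡n (<⇒≤ n<m) | m≥n⇒m⊓n≡n n<m = +-comm n 1
... | no n≮m
  rewrite ≥⇒<ᵇ≡false (≮⇒≥ n≮m) | sumTo-indicator m n
        | m≤n⇒m⊓n≡m (≮⇒≥ n≮m) | m≤n⇒m⊓n≡m (m≤n⇒m≤1+n (≮⇒≥ n≮m)) = +-identityʳ m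

sumTo-shift : ∀ n (f : ℕ → ℕ) → sumTo f (suc n) ≡ f 0 + sumTo (f ∘ suc) n
sumTo-shift zero    f = +-comm 0 (f 0)
sumTo-shift (suc n) f = trans (cong (_+ f (suc n)) (sumTo-shift n f)) (+-assoc (f 0) _ _)

sumFin-toℕ : ∀ n (f : ℕ → ℕ) → sumFin {n} (f ∘ toℕ) ≡ sumTo f n
sumFin-toℕ zero    f = refl
sumFin-toℕ (suc n) f = trans (cong (f 0 +_) (sumFin-toℕ n (f ∘ suc))) (sym (sumTo-shift n f))

ext-toℕ : ∀ {r} (v : Fin r → ℕ) i → ext v (toℕ i) ≡ v i
ext-toℕ {suc r} v fzero    = refl
ext-toℕ {suc r} v (fsuc i) = ext-toℕ (v ∘ fsuc) i

ext-≥ : ∀ {r} (v : Fin r → ℕ) {k} → r ≤ k → ext v k ≡ 0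
ext-≥ {zero}  v         _       = refl
ext-≥ {suc r} v {suc k} 1+r≤1+k = ext-≥ (v ∘ fsuc) (s≤s⁻¹ 1+r≤1+k)

ext-fromℕ< : ∀ {r} (v : Fin r → ℕ) {k} (k<r : k < r) → ext v k ≡ v (fromℕ< k<r)
ext-fromℕ< v k<r = trans (cong (ext v) (sym (toℕ-fromℕ< k<r))) (ext-toℕ v (fromℕ< k<r))

ext-∘toℕ : ∀ {r} (f : ℕ → ℕ) k → ext {r} (f ∘ toℕ) k ≡ (if k <ᵇ r then f k else 0)
ext-∘toℕ {zero}  f k       = refl
ext-∘toℕ {suc r} f zero    = refl
ext-∘toℕ {suc r} f (suc k) = ext-∘toℕ {r} (f ∘ suc) k

ext-+ : ∀ {r} {u v w : Fin r → ℕ} → (∀ i → u i + v i ≡ w i) →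
  ∀ k → ext u k + ext v k ≡ ext w k
ext-+ {zero}  u+v≗w k       = refl
ext-+ {suc r} u+v≗w zero    = u+v≗w fzero
ext-+ {suc r} u+v≗w (suc k) = ext-+ (u+v≗w ∘ fsuc) k

suc-step⇒antitone : ∀ {f : ℕ → ℕ} → (∀ k → f (suc k) ≤ f k) → f Preserves _≤_ ⟶ (λ m n → n ≤ m)
suc-step⇒antitone step {m} {zero}  z≤n   = ≤-refl
suc-step⇒antitone step {m} {suc n} m≤1+n with m≤n⇒m<n∨m≡n m≤1+n
... | inj₁ m<1+n = ≤-trans (step n) (suc-step⇒antitone step (s≤s⁻¹ m<1+n))
... | inj₂ refl  = ≤-refl

WeaklyDecreasing⇔ext-descends : ∀ {r} (v : Fin r → ℕ) →
  WeaklyDecreasing v ⇔ (∀ i → ext v (suc (toℕ i)) ≤ ext v (toℕ i))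
WeaklyDecreasing⇔ext-descends {r} v = mk⇔ descends decreasing
  where
  descends : WeaklyDecreasing v → ∀ i → ext v (suc (toℕ i)) ≤ ext v (toℕ i)
  descends dec i with suc (toℕ i) <? r
  ... | no  i+1≮r rewrite ext-≥ v (≮⇒≥ i+1≮r) = z≤n
  ... | yes i+1<r rewrite ext-fromℕ< v i+1<r | ext-toℕ v i =
    dec i (fromℕ< i+1<r) (subst (toℕ i ≤_) (sym (toℕ-fromℕ< i+1<r)) (n≤1+n (toℕ i)))
  decreasing : (∀ i → ext v (suc (toℕ i)) ≤ ext v (toℕ i)) → WeaklyDecreasing v
  decreasing desc i j i≤j =
    subst₂ _≤_ (ext-toℕ v j) (ext-toℕ v i) (suc-step⇒antitone descends-everywhere i≤j)
    where
    descends-everywhere : ∀ k → ext v (suc k) ≤ ext v k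
    descends-everywhere k with k <? r
    ... | yes k<r = subst (λ x → ext v (suc x) ≤ ext v x) (toℕ-fromℕ< k<r) (desc (fromℕ< k<r))
    ... | no  k≮r rewrite ext-≥ v (m≤n⇒m≤1+n (≮⇒≥ k≮r)) = z≤n

colSum-complement : ∀ {r s} (A : Fin r → Fin s → ℕ) S i →
  colSum A S i + colSum A (not ∘ S) i ≡ sumFin (A i)
colSum-complement {s = zero}  A S i = refl
colSum-complement {s = suc s} A S i with S fzero
... | true  = trans (+-assoc (A i fzero) _ _)
                (cong (A i fzero +_) (colSum-complement (λ i → A i ∘ fsuc) (S ∘ fsuc) i))
... | false = trans (x∙yz≈y∙xz (colSum (λ i → A i ∘ fsuc) (S ∘ fsuc) i) (A i fzero) _)
                (cong (A i fzero +_) (colSum-complement (λ i → A i ∘ fsuc) (S ∘ fsuc) i))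

colSum-zero : ∀ {r s} S (i : Fin r) → colSum {s = s} (λ _ _ → 0) S i ≡ 0
colSum-zero {s = zero}  S i = refl
colSum-zero {s = suc s} S i with S fzero
... | true  = colSum-zero (S ∘ fsuc) i
... | false = colSum-zero (S ∘ fsuc) i

colSum-if : ∀ {r s} (b : Fin r → Bool) (A : Fin r → Fin s → ℕ) S i →
  colSum (λ i c → if b i then A i c else 0) S i ≡ (if b i then colSum A S i else 0)
colSum-if b A S i with b i
... | true  = refl
... | false = colSum-zero S i

[a+c]-[b+d]≡[a-b]+[c-d] : ∀ a b c d →
  ℤ.+ (a + c) ℤ.- ℤ.+ (b + d) ≡ (ℤ.+ a ℤ.- ℤ.+ b) ℤ.+ (ℤ.+ c ℤ.- ℤ.+ d)
[a+c]-[b+d]≡[a-b]+[c-d] a b c d rewrite ℤ.pos-+ a c | ℤ.pos-+ b d = regroup (ℤ.+ a) (ℤ.+ b) (ℤ.+ c) (ℤ.+ d)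
  where
  regroup : ∀ w x y z → (w ℤ.+ y) ℤ.- (x ℤ.+ z) ≡ (w ℤ.- x) ℤ.+ (y ℤ.- z)
  regroup = solve-∀

colSumℤ-difference : ∀ {r s} (f g : Fin r → Fin s → ℕ) S i →
  colSumℤ (λ i c → ℤ.+ f i c ℤ.- ℤ.+ g i c) S i ≡ ℤ.+ colSum f S i ℤ.- ℤ.+ colSum g S i
colSumℤ-difference {s = zero}  f g S i = refl
colSumℤ-difference {s = suc s} f g S i with S fzero
... | true  = trans
    (cong (ℤ._+_ (ℤ.+ f i fzero ℤ.- ℤ.+ g i fzero))
      (colSumℤ-difference (λ i → f i ∘ fsuc) (λ i → g i ∘ fsuc) (S ∘ fsuc) i))
    (sym ([a+c]-[b+d]≡[a-b]+[c-d] (f i fzero) (g i fzero) _ _))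
... | false = trans (ℤ.+-identityˡ _)
    (colSumℤ-difference (λ i → f i ∘ fsuc) (λ i → g i ∘ fsuc) (S ∘ fsuc) i)

0≤a-b≤[a+c]-[b+d]⇔b≤a×d≤c : ∀ a b c d →
  (0ℤ ℤ.≤ ℤ.+ a ℤ.- ℤ.+ b × ℤ.+ a ℤ.- ℤ.+ b ℤ.≤ ℤ.+ (a + c) ℤ.- ℤ.+ (b + d)) ⇔ (b ≤ a × d ≤ c)
0≤a-b≤[a+c]-[b+d]⇔b≤a×d≤c a b c d rewrite [a+c]-[b+d]≡[a-b]+[c-d] a b c d = mk⇔
  (λ (0≤x , x≤x+y) → ℤ.drop‿+≤+ (ℤ.0≤i-j⇒j≤i 0≤x) ,
                      ℤ.drop‿+≤+ (ℤ.0≤i-j⇒j≤i (subst (0ℤ ℤ.≤_) (x+y-x≡y x y) (ℤ.i≤j⇒0≤j-i x≤x+y))))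
  (λ (b≤a , d≤c) → ℤ.i≤j⇒0≤j-i (+≤+ b≤a) ,
                    subst (ℤ._≤ x ℤ.+ y) (ℤ.+-identityʳ x) (ℤ.+-monoʳ-≤ x (ℤ.i≤j⇒0≤j-i (+≤+ d≤c))))
  where
  x y : ℤ
  x = ℤ.+ a ℤ.- ℤ.+ b
  y = ℤ.+ c ℤ.- ℤ.+ d
  x+y-x≡y : ∀ x y → (x ℤ.+ y) ℤ.- x ≡ y
  x+y-x≡y = solve-∀

ZeroOne : (ℕ → ℕ) → Set
ZeroOne row = ∀ c → row c ≤ 1

rightmostOne-just : ∀ M k i {p} → rightmostOne M k i ≡ just p → p < k × M i p ≡ 1
rightmostOne-just M (suc k) i eq with M i k ≡ᵇ 1 in e
rightmostOne-just M (suc k) i refl | true  = n<1+n k , ≡ᵇ⇒≡ (M i k) 1 (Equivalence.from T-≡ e)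
rightmostOne-just M (suc k) i eq   | false = map₁ m<n⇒m<1+n (rightmostOne-just M k i eq)

rightmostOne-last : ∀ M q i {p} → rightmostOne M (suc q) i ≡ just p → p ≢ q → M i q ≢ 1
rightmostOne-last M q i eq p≢q with M i q ≡ᵇ 1 in e
rightmostOne-last M q i refl p≢q | true  = ⊥-elim (p≢q refl)
rightmostOne-last M q i eq   p≢q | false = λ Miq≡1 → subst T e (≡⇒≡ᵇ (M i q) 1 Miq≡1)

moveRow-zeroOne : ∀ {row} mp k → ZeroOne row → ZeroOne (moveRow row mp k)
moveRow-zeroOne nothing  k zo c = zo c
moveRow-zeroOne (just p) k zo c with c ≡ᵇ (k ∸ 1) | c ≡ᵇ p
... | true  | _     = ≤-refl
... | false | true  = z≤n
... | false | false = zo c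

moveRow-sumTo : ∀ {row p q s} → p ≤ q → q < s → row p ≡ 1 → (p ≢ q → row q ≡ 0) →
  sumTo (moveRow row (just p) (suc q)) s ≡ sumTo row s
moveRow-sumTo {row} {p} {q} {s} p≤q q<s row[p]≡1 row[q]≡0 with p ≟ q
... | yes refl = sumTo-cong s unchanged
  where
  unchanged : ∀ c → c < s → moveRow row (just p) (suc p) c ≡ row c
  unchanged c _ with c ≟ p
  ... | yes refl rewrite ≡ᵇ-refl c = sym row[p]≡1
  ... | no  c≢p  rewrite ≢⇒≡ᵇ≡false c≢p = refl
... | no p≢q = begin
  sumTo g s            ≡⟨ +-identityʳ _ ⟨
  sumTo g s + 0        ≡⟨ cong (sumTo g s +_) h[q]≡0 ⟨
  sumTo g s + h q      ≡⟨ sumTo-update s q<s (λ c c≢q → if-cong (≢⇒≡ᵇ≡false c≢q)) ⟩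
  sumTo h s + g q      ≡⟨ cong (λ b → sumTo h s + (if b then 1 else h q)) (≡ᵇ-refl q) ⟩
  sumTo h s + 1        ≡⟨ cong (sumTo h s +_) row[p]≡1 ⟨
  sumTo h s + row p    ≡⟨ sumTo-update s (≤-<-trans p≤q q<s) (λ c c≢p → if-cong (≢⇒≡ᵇ≡false c≢p)) ⟩
  sumTo row s + h p    ≡⟨ cong (λ b → sumTo row s + (if b then 0 else row p)) (≡ᵇ-refl p) ⟩
  sumTo row s + 0      ≡⟨ +-identityʳ _ ⟩
  sumTo row s          ∎
  where
  open ≡-Reasoning
  g h : ℕ → ℕ
  g = moveRow row (just p) (suc q)
  h c = if c ≡ᵇ p then 0 else row c
  h[q]≡0 : h q ≡ 0
  h[q]≡0 = trans (if-cong (≢⇒≡ᵇ≡false (p≢q ∘ sym))) (row[q]≡0 p≢q)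

step-preserves : ∀ {r} (lam : Fin r → ℕ) M {q s} → q < s → ∀ i → ZeroOne (M i) →
  ZeroOne (step lam M (suc q) i) × sumTo (step lam M (suc q) i) s ≡ sumTo (M i) s
step-preserves {r} lam M {q} q<s i zo with chosen r M (suc q) (conj lam (suc q)) i
... | false = zo , refl
... | true with rightmostOne M (suc q) i in eq
...   | nothing = zo , refl
...   | just p  = moveRow-zeroOne (just p) (suc q) zo ,
                  moveRow-sumTo (s≤s⁻¹ p<1+q) q<s M[i,p]≡1
                    (λ p≢q → n≤0⇒n≡0 (s≤s⁻¹ (≤∧≢⇒< (zo q) (rightmostOne-last M q i eq p≢q))))
  where
  p<1+q : p < suc q
  p<1+q = proj₁ (rightmostOne-just M (suc q) i eq)
  M[i,p]≡1 : M i p ≡ 1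
  M[i,p]≡1 = proj₂ (rightmostOne-just M (suc q) i eq)

run-preserves : ∀ {r} (lam : Fin r → ℕ) {s} k M → k ≤ s → (∀ i → ZeroOne (M i)) →
  (∀ i → ZeroOne (run lam M k i)) × (∀ i → sumTo (run lam M k i) s ≡ sumTo (M i) s)
run-preserves lam zero    M _     zo = zo , λ i → refl
run-preserves lam {s} (suc k) M 1+k≤s zo =
  proj₁ later , λ i → trans (proj₂ later i) (proj₂ (step-preserves lam M 1+k≤s i (zo i)))
  where
  later : (∀ i → ZeroOne (run lam M (suc k) i)) ×
          (∀ i → sumTo (run lam M (suc k) i) s ≡ sumTo (step lam M (suc k) i) s)
  later = run-preserves lam k (step lam M (suc k)) (<⇒≤ 1+k≤s)
            (λ i → proj₁ (step-preserves lam M 1+k≤s i (zo i)))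

initMat-zeroOne : ∀ {r} (mu : Fin r → ℕ) i → ZeroOne (initMat mu i)
initMat-zeroOne mu i c with c <ᵇ ext mu i
... | true  = ≤-refl
... | false = z≤n

Kostka⇒≤firstPart : ∀ {r lam mu} → Kostka r lam mu → ∀ i → mu i ≤ firstPart lam
Kostka⇒≤firstPart {suc r} (_ , mu-dec , _ , dominance) i =
  ≤-trans (mu-dec fzero i z≤n) (dominance 1 (s≤s z≤n))

canonical-rowSum : ∀ {r lam mu} → Kostka r lam mu → ∀ i → sumFin (canonical lam mu i) ≡ mu i
canonical-rowSum {r} {lam} {mu} K i = begin
  sumFin (canonical lam mu i)                  ≡⟨ sumFin-toℕ s (R (toℕ i)) ⟩
  sumTo (R (toℕ i)) s                          ≡⟨ proj₂ (run-preserves lam s (initMat mu) ≤-refl (initMat-zeroOne mu)) (toℕ i) ⟩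
  sumTo (λ c → if c <ᵇ ext mu (toℕ i) then 1 else 0) s ≡⟨ sumTo-indicator (ext mu (toℕ i)) s ⟩
  ext mu (toℕ i) ⊓ s                           ≡⟨ m≤n⇒m⊓n≡m (subst (_≤ s) (sym (ext-toℕ mu i)) (Kostka⇒≤firstPart K i)) ⟩
  ext mu (toℕ i)                               ≡⟨ ext-toℕ mu i ⟩
  mu i                                         ∎
  where
  open ≡-Reasoning
  s : ℕ
  s = firstPart lam
  R : Mat
  R = run lam (initMat mu) s

module _ {r} {lam mu : Fin r → ℕ} (K : Kostka r lam mu) where

  private
    A : Fin r → Fin (firstPart lam) → ℕ
    A = canonical lam mu
    A* : Fin r → Fin (firstPart lam) → ℤ
    A* = canonicalStar lam mu

  canonicalStar-colSum : ∀ S i →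
    colSumℤ A* S i ≡ ℤ.+ ext (colSum A S) (toℕ i) ℤ.- ℤ.+ ext (colSum A S) (suc (toℕ i))
  canonicalStar-colSum S i = trans (colSumℤ-difference (row ∘ toℕ) (row ∘ suc ∘ toℕ) S i)
    (cong₂ (λ x y → ℤ.+ x ℤ.- ℤ.+ y) (colSum-row (toℕ i)) (colSum-row (suc (toℕ i))))
    where
    R : Mat
    R = run lam (initMat mu) (firstPart lam)
    row : ℕ → Fin (firstPart lam) → ℕ
    row k c = if k <ᵇ r then R k (toℕ c) else 0
    colSum-row : ∀ k → colSum (λ _ → row k) S i ≡ ext (colSum A S) k
    colSum-row k = trans (colSum-if (λ _ → k <ᵇ r) (λ _ c → R k (toℕ c)) S i)
      (sym (ext-∘toℕ {r} (λ k → sumFin (λ c → if S c then R k (toℕ c) else 0)) k))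

  muStar-colSums : ∀ S i → muStar mu i ≡
    ℤ.+ (ext (colSum A S) (toℕ i) + ext (colSum A (not ∘ S)) (toℕ i))
      ℤ.- ℤ.+ (ext (colSum A S) (suc (toℕ i)) + ext (colSum A (not ∘ S)) (suc (toℕ i)))
  muStar-colSums S i = cong₂ (λ x y → ℤ.+ x ℤ.- ℤ.+ y) (sym (split (toℕ i))) (sym (split (suc (toℕ i))))
    where
    split : ∀ k → ext (colSum A S) k + ext (colSum A (not ∘ S)) k ≡ ext mu k
    split = ext-+ (λ i → trans (colSum-complement A S i) (canonical-rowSum K i))

  starCondition⇔descends : ∀ S i →
    (0ℤ ℤ.≤ colSumℤ A* S i × colSumℤ A* S i ℤ.≤ muStar mu i) ⇔
    (ext (colSum A S) (suc (toℕ i)) ≤ ext (colSum A S) (toℕ i) ×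
     ext (colSum A (not ∘ S)) (suc (toℕ i)) ≤ ext (colSum A (not ∘ S)) (toℕ i))
  starCondition⇔descends S i rewrite canonicalStar-colSum S i | muStar-colSums S i =
    0≤a-b≤[a+c]-[b+d]⇔b≤a×d≤c _ _ _ _

  starCondition⇔partitions : ∀ S →
    (∀ i → 0ℤ ℤ.≤ colSumℤ A* S i × colSumℤ A* S i ℤ.≤ muStar mu i) ⇔
    (IsPartition (colSum A S) × IsPartition (colSum A (not ∘ S)))
  starCondition⇔partitions S = mk⇔
    (λ cond → from (WeaklyDecreasing⇔ext-descends _) (λ i → proj₁ (to (starCondition⇔descends S i) (cond i))) ,
              from (WeaklyDecreasing⇔ext-descends _) (λ i → proj₂ (to (starCondition⇔descends S i) (cond i))))
    (λ (dec , dec̅) i → from (starCondition⇔descends S i)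
      (to (WeaklyDecreasing⇔ext-descends _) dec i , to (WeaklyDecreasing⇔ext-descends _) dec̅ i))
    where open Equivalence

proposition2p20 : (r : ℕ) (lam mu : Fin r → ℕ) → Kostka r lam mu →
    StarReducible (canonicalStar lam mu) (muStar mu) ⇔ Reducible (canonical lam mu)
proposition2p20 r lam mu K = mk⇔
  (λ (S , nontrivial , cond) → S , nontrivial , Equivalence.to (starCondition⇔partitions K S) cond)
  (λ (S , nontrivial , dec) → S , nontrivial , Equivalence.from (starCondition⇔partitions K S) dec)
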